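{- The $\mathcal{SDD}$ size of $\mathrm{HWB}_n$ is $O(n^3)$.
   Context: $\mathrm{HWB}_n(x_1,\ldots,x_n)$ (hidden weighted bit) is the boolean function such that an assignment $f:\{x_1,\dots,x_n\}\to\{0,1\}$ is a model iff, letting $i=f(x_1)+\cdots+f(x_n)$, we have $i\ge 1$ and $f(x_i)=1$. Circuits are NNFs: boolean circuits (DAGs with a single output gate) whose input gates are labelled by constants $\bot,\top$ or literals on variables, and whose internal gates are unbounded-fanin $\vee$- and $\wedge$-gates; a circuit need not read all variables of the vtree it respects. The size of a circuit is the number of arcs of its DAG. $C_g$ denotes the subcircuit with output gate $g$. For a class $\mathcal{L}$ and boolean function $f$, the $\mathcal{L}$ size of $f$ is the minimum size of a circuit in $\mathcal{L}$ computing $f$. A vtree for a finite nonempty variable set $Y$ is a rooted, full, ordered binary tree whose leaves are identified bijectively with $Y$; for an internal node $v$, $v_l,v_r$ are its children, $T_v$ the subtree rooted at $v$, $Y_v$ its leaf set. An SDD respecting a vtree $T$ is defined inductively: (i) a single gate labelled by a literal on a variable that is a leaf of $T$; (ii) a single gate labelled by a constant (any $T$); (iii) $C=\bigvee_{i=1}^m (C_{p_i}\wedge C_{s_i})$ with $m\ge 2$ (output $\vee$-gate with wires from $m$ $\wedge$-gates, the $i$-th with wires from gates $p_i,s_i$) such that for some internal node $v$ of $T$ and all $i$: $C_{p_i}$ is an SDD respecting a subtree of $T_{v_l}$, $C_{s_i}$ is an SDD respecting a subtree of $T_{v_r}$, and as functions on $Y_{v_l}$: $C_{p_i}\not\equiv\bot$,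 $C_{p_i}\wedge C_{p_j}\equiv\bot$ for $i<j$, $\bigvee_i C_{p_i}\equiv\top$. $\mathcal{SDD}$ is the class of all circuits that are SDDs respecting some vtree. -}

module Defs where

open import Data.Nat using (ℕ; zero; suc; _+_; _≤_)
open import Data.Fin using (Fin; zero; suc; toℕ)
open import Data.Bool using (Bool; true; false; not; if_then_else_)
open import Data.List using (List; []; _∷_; length; lookup; map; allFin)
open import Data.Nat.ListAction using (sum)
import Data.Bool.ListAction as BL
import Data.List as L
open import Data.List.Membership.Propositional using (_∈_)
open import Data.List.Relation.Unary.Unique.Propositional using (Unique)
open import Data.Product using (Σ; ∃; _×_; _,_)
open import Relation.Binary.PropositionalEquality using (_≡_; _≢_)
open import Function.Bundles using (_⇔_)

data VTree (n : ℕ) : Set where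
  leaf : Fin n → VTree n
  node : VTree n → VTree n → VTree n

leaves : ∀ {n} → VTree n → List (Fin n)
leaves (leaf x)   = x ∷ []
leaves (node l r) = leaves l L.++ leaves r

IsVTree : ∀ {n} → VTree n → Set
IsVTree {n} T = Unique (leaves T) × (∀ (x : Fin n) → x ∈ leaves T)

data _⊑_ {n : ℕ} : VTree n → VTree n → Set where
  here  : ∀ {T} → T ⊑ T
  left  : ∀ {S l r} → S ⊑ l → S ⊑ node l r
  right : ∀ {S l r} → S ⊑ r → S ⊑ node l r

-- NNF circuits as DAGs: a gate may only read earlier gates.
-- Gate n k : a gate over variables Fin n that may read the k earlier gates.

data Gate (n k : ℕ) : Set where
  const : Bool → Gate n k
  lit   : Fin n → Bool → Gate n k
  ∨g    : List (Fin k) → Gate n k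
  ∧g    : List (Fin k) → Gate n k

-- Circ n k : a DAG of k gates; index zero is the most recently added gate,
-- suc i refers to gate i of the prefix.
data Circ (n : ℕ) : ℕ → Set where
  []  : Circ n 0
  _▷_ : ∀ {k} → Circ n k → Gate n k → Circ n (suc k)

-- a circuit: nonempty DAG whose output gate is the last gate added
Circuit : ℕ → Set
Circuit n = Σ ℕ (λ m → Circ n (suc m))

eval : ∀ {n k} → Circ n k → (Fin n → Bool) → Fin k → Bool
evalGate : ∀ {n k} → Gate n k → (Fin n → Bool) → (Fin k → Bool) → Bool
evalGate (const b) a v = b
evalGate (lit x p) a v = if p then a x else not (a x)
evalGate (∨g ws)   a v = BL.or  (map v ws)
evalGate (∧g ws)   a v = BL.and (map v ws)
eval (C ▷ g) a zero    = evalGate g a (eval C a)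
eval (C ▷ g) a (suc i) = eval C a i

⟦_⟧ : ∀ {n} → Circuit n → (Fin n → Bool) → Bool
⟦ (m , C) ⟧ a = eval C a zero

-- size = number of arcs (sum of fan-ins)
gateSize : ∀ {n k} → Gate n k → ℕ
gateSize (const _) = 0
gateSize (lit _ _) = 0
gateSize (∨g ws)   = length ws
gateSize (∧g ws)   = length ws

circSize : ∀ {n k} → Circ n k → ℕ
circSize []      = 0
circSize (C ▷ g) = circSize C + gateSize g

size : ∀ {n} → Circuit n → ℕ
size (m , C) = circSize C

-- the subcircuit C_g with output gate g (the prefix of the DAG ending at g)
sub : ∀ {n k} → Circ n k → Fin k → Circuit n
sub (C ▷ g) zero    = (_ , C ▷ g)
sub (C ▷ g) (suc i) = sub C i

data AndGate {n : ℕ} : Circuit n → Circuit n → Circuit n → Set where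
  mk : ∀ {k} (C : Circ n k) (p s : Fin k) →
       AndGate (k , C ▷ ∧g (p ∷ s ∷ [])) (sub C p) (sub C s)

data SDD {n : ℕ} : VTree n → Circuit n → Set where
  sdd-lit   : ∀ {T k} (C : Circ n k) (x : Fin n) (b : Bool) →
              x ∈ leaves T → SDD T (k , C ▷ lit x b)
  sdd-const : ∀ {T k} (C : Circ n k) (b : Bool) → SDD T (k , C ▷ const b)
  sdd-dec   : ∀ {T k vl vr} (C : Circ n k) (ws : List (Fin k)) →
              2 ≤ length ws →
              node vl vr ⊑ T →
              (P S : Fin (length ws) → Circuit n) →
              (∀ i → AndGate (sub C (lookup ws i)) (P i) (S i)) →
              (∀ i → ∃ λ Tp → Tp ⊑ vl × SDD Tp (P i)) →
              (∀ i → ∃ λ Ts → Ts ⊑ vr × SDD Ts (S i)) →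
              (∀ i → ∃ λ (a : Fin n → Bool) → ⟦ P i ⟧ a ≡ true) →
              (∀ i j → i ≢ j → ∀ a → ⟦ P i ⟧ a ≡ true → ⟦ P j ⟧ a ≡ false) →
              (∀ a → ∃ λ i → ⟦ P i ⟧ a ≡ true) →
              SDD T (k , C ▷ ∨g ws)

IsSDD : ∀ {n} → Circuit n → Set
IsSDD {n} C = ∃ λ (T : VTree n) → IsVTree T × SDD T C

weight : ∀ {n} → (Fin n → Bool) → ℕ
weight {n} f = sum (map (λ i → if f i then 1 else 0) (allFin n))

-- f is a model of HWB_n iff i = weight f ≥ 1 and f(x_i) = 1 (1-indexed)
HWB : (n : ℕ) → (Fin n → Bool) → Set
HWB n f = Σ (Fin n) λ i → suc (toℕ i) ≡ weight f × f i ≡ true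

Computes : ∀ {n} → Circuit n → ((Fin n → Bool) → Set) → Set
Computes {n} C F = ∀ (a : Fin n → Bool) → (⟦ C ⟧ a ≡ true) ⇔ F a

-- The vtree puts x₂ … xₙ (a right-linear chain) to the left of x₁.  Call the
-- key of x₂ … xₙ their weight j together with their bits at positions j − 1
-- and j; once the key is known, HWB_n is a function of x₁ alone (`decide`).
-- The root is therefore a decision node with one element per realisable key
-- (there are at most 4n keys): the prime accepts exactly the assignments of
-- x₂ … xₙ with that key, the sub is a literal or a constant on x₁.  A prime is
-- recognised by a layered automaton that counts ones down from j and probes
-- two positions; an automaton of width B over a chain vtree has an SDD (its
-- OBDD) with 6B arcs per layer, so with B = n each key costs 6mn + 2 arcs.
module Submission where

open import Defs
open import Data.Bool using (Bool; true; false; not; if_then_else_; _∧_; _∨_)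
open import Data.Bool.Properties using (if-eta; ∧-identityʳ; ∧-zeroʳ; ∨-identityʳ; ¬-not; T-≡)
import Data.Bool.Properties as Bool
import Data.Bool.ListAction as BL
open import Data.Empty using (⊥; ⊥-elim)
open import Data.Fin using (Fin; zero; suc; toℕ)
import Data.Fin.Properties as Fin
open import Data.List
  using (List; []; _∷_; _++_; length; lookup; map; tabulate; cartesianProduct; upTo)
open import Data.List.Properties
  using (map-cong; map-∘; map-tabulate; length-++; length-map; length-upTo)
open import Data.List.Membership.Propositional using (_∈_)
open import Data.List.Membership.Propositional.Properties
  using ( ∈-lookup; ∈-++⁺ˡ; ∈-++⁺ʳ; ∈-tabulate⁺; ∈-tabulate⁻; ∈-upTo⁺; ∈-upTo⁻
        ; ∈-cartesianProduct⁺; ∈-cartesianProduct⁻)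
import Data.List.Relation.Binary.Disjoint.Propositional as Lists
open import Data.List.Relation.Unary.All as All using (All; []; _∷_)
import Data.List.Relation.Unary.All.Properties as AllP
open import Data.List.Relation.Unary.AllPairs using (AllPairs; []; _∷_)
open import Data.List.Relation.Unary.Any as Any using (Any; here; there)
open import Data.List.Relation.Unary.Any.Properties using (lookup-index; any⁺; any⁻)
  renaming (map⁻ to any-map⁻)
open import Data.List.Relation.Unary.Unique.Propositional using (Unique)
import Data.List.Relation.Unary.Unique.Propositional.Properties as Unique
open import Data.Maybe using (Maybe; just; nothing)
open import Data.Nat using (ℕ; zero; suc; _+_; _*_; _^_; _≤_; _<_; _∸_; z≤n; s≤s; s≤s⁻¹; _≡ᵇ_; _≟_)
open import Data.Nat.ListAction using (sum)
open import Data.Nat.Properties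
open import Data.Nat.Tactic.RingSolver using (solve-∀)
open import Data.Product using (Σ; ∃; _×_; _,_; proj₁; proj₂)
open import Data.Sum using (_⊎_; inj₁; inj₂)
open import Data.Unit using (⊤; tt)
open import Data.Vec.Functional using () renaming (_∷_ to _◂_)
open import Function using (_∘_; id)
open import Function.Bundles using (_⇔_; mk⇔; Equivalence)
open import Relation.Binary.PropositionalEquality
open import Relation.Nullary using (yes; no; Dec; ¬_)
open import Relation.Nullary.Decidable using (map′; _⊎-dec_)

-- Facts about lists.  The first two read off a property of `map f xs` at the
-- positions of xs, the form in which the SDD constructor indexes its elements.
all-at : ∀ {A B : Set} {Q : B → Set} {f : A → B} {xs : List A} →
         All Q (map f xs) → ∀ i → Q (f (lookup xs i))
all-at qs i = All.lookup (AllP.map⁻ qs) (∈-lookup i)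

any-at : ∀ {A B : Set} {Q : B → Set} {f : A → B} {xs : List A} →
         Any Q (map f xs) → ∃ λ i → Q (f (lookup xs i))
any-at q = Any.index (any-map⁻ q) , lookup-index (any-map⁻ q)

any-with : ∀ {A : Set} {P Q R : A → Set} {xs} → All P xs → Any Q xs →
           (∀ {x} → P x → Q x → R x) → Any R xs
any-with (p ∷ ps) (here q)  f = here (f p q)
any-with (p ∷ ps) (there q) f = there (any-with ps q f)

at-least-two : ∀ {A : Set} {P Q : A → Set} {xs} → Any P xs → Any Q xs →
               (∀ {x} → P x → Q x → ⊥) → 2 ≤ length xs
at-least-two {xs = _ ∷ _ ∷ _} _        _          _    = s≤s (s≤s z≤n)
at-least-two {xs = _ ∷ []}    (here p) (here q)   excl = ⊥-elim (excl p q)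
at-least-two {xs = _ ∷ []}    (here p) (there ())  excl
at-least-two {xs = _ ∷ []}    (there ()) _         excl

length-cartesianProduct : ∀ {A B : Set} (xs : List A) (ys : List B) →
                          length (cartesianProduct xs ys) ≡ length xs * length ys
length-cartesianProduct []       ys = refl
length-cartesianProduct (x ∷ xs) ys = begin
  length (map (x ,_) ys ++ cartesianProduct xs ys)       ≡⟨ length-++ (map (x ,_) ys) ⟩
  length (map (x ,_) ys) + length (cartesianProduct xs ys) ≡⟨ cong₂ _+_ (length-map (x ,_) ys)
                                                                    (length-cartesianProduct xs ys) ⟩
  length ys + length xs * length ys                      ∎
  where open ≡-Reasoning

-- Gates already present keep their subcircuits, so properties
-- stated through subcircuits persist while the circuit grows.

record _≼_ {n k k'} (C : Circ n k) (C' : Circ n k') : Set where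
  field
    lift : Fin k → Fin k'
    sub-lift : ∀ i → sub C' (lift i) ≡ sub C i
open _≼_

≼-refl : ∀ {n k} {C : Circ n k} → C ≼ C
≼-refl = record { lift = id ; sub-lift = λ _ → refl }

≼-snoc : ∀ {n k} {C : Circ n k} (g : Gate n k) → C ≼ (C ▷ g)
≼-snoc g = record { lift = suc ; sub-lift = λ _ → refl }

≼-trans : ∀ {n k k' k''} {C : Circ n k} {C' : Circ n k'} {C'' : Circ n k''} →
          C ≼ C' → C' ≼ C'' → C ≼ C''
≼-trans E F = record { lift = lift F ∘ lift E
                     ; sub-lift = λ i → trans (sub-lift F (lift E i)) (sub-lift E i) }

CircPred : ℕ → Set₁
CircPred n = ∀ {k} → Circ n k → Set

Persistent : ∀ {n} → CircPred n → Set
Persistent {n} P = ∀ {k k'} {C : Circ n k} {C' : Circ n k'} → C ≼ C' → P C → P C'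

record Has {n} (Q : Circuit n → Set) {k} (C : Circ n k) : Set where
  constructor _,_
  field
    gate    : Fin k
    gate-ok : Q (sub C gate)

has-persistent : ∀ {n} (Q : Circuit n → Set) → Persistent (Has Q)
has-persistent Q E (i , q) = lift E i , subst Q (sym (sub-lift E i)) q

Tabulated : ∀ {n} → (ℕ → Circuit n → Set) → ℕ → CircPred n
Tabulated Q r C = ∀ c → c < r → Has (Q c) C

tabulated-persistent : ∀ {n} (Q : ℕ → Circuit n → Set) r → Persistent (Tabulated Q r)
tabulated-persistent Q r E tab c c<r = has-persistent (Q c) E (tab c c<r)

×-persistent : ∀ {n} {P Q : CircPred n} → Persistent P → Persistent Q →
               Persistent (λ C → P C × Q C)
×-persistent pP pQ E (p , q) = pP E p , pQ E q

record Growth {n k} (C : Circ n k) (P : CircPred n) (δ : ℕ) : Set where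
  constructor grown
  field
    {gates} : ℕ
    result  : Circ n gates
    extends : C ≼ result
    holds   : P result
    bounded : circSize result ≤ circSize C + δ

stay : ∀ {n k} {C : Circ n k} {P : CircPred n} → P C → Growth C P 0
stay {C = C} p = grown C ≼-refl p (≤-reflexive (sym (+-identityʳ (circSize C))))

append : ∀ {n k} {C : Circ n k} (g : Gate n k) {P : CircPred n} →
         P (C ▷ g) → Growth C P (gateSize g)
append {C = C} g p = grown (C ▷ g) (≼-snoc g) p ≤-refl

weaken : ∀ {n k} {C : Circ n k} {P : CircPred n} {δ δ'} → δ ≤ δ' → Growth C P δ → Growth C P δ'
weaken {C = C} δ≤δ' (grown R E p b) = grown R E p (≤-trans b (+-monoʳ-≤ (circSize C) δ≤δ'))

infixl 1 _>>=_
_>>=_ : ∀ {n k} {C : Circ n k} {P Q : CircPred n} {δ ε} →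
        Growth C P δ → (∀ {k'} (C' : Circ n k') → P C' → Growth C' Q ε) → Growth C Q (δ + ε)
_>>=_ {C = C} {δ = δ} {ε} (grown R E p b) next with next R p
... | grown R' E' q b' = grown R' (≼-trans E E') q (begin
  circSize R'              ≤⟨ b' ⟩
  circSize R + ε           ≤⟨ +-monoˡ-≤ ε b ⟩
  circSize C + δ + ε       ≡⟨ +-assoc (circSize C) δ ε ⟩
  circSize C + (δ + ε)     ∎)
  where open ≤-Reasoning

growth-map : ∀ {n k} {C : Circ n k} {P Q : CircPred n} {δ} →
             (∀ {k'} {C' : Circ n k'} → P C' → Q C') → Growth C P δ → Growth C Q δ
growth-map f (grown R E p b) = grown R E (f p) b

along : ∀ {n k} {C : Circ n k} {P Q : CircPred n} {δ} → Persistent P → P C →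
        Growth C Q δ → Growth C (λ C' → P C' × Q C') δ
along pP p (grown R E q b) = grown R E (pP E p , q) b

eval-sub : ∀ {n k} (C : Circ n k) (a : Fin n → Bool) (i : Fin k) → ⟦ sub C i ⟧ a ≡ eval C a i
eval-sub (C ▷ g) a zero    = refl
eval-sub (C ▷ g) a (suc i) = eval-sub C a i

Realises : ∀ {n} → VTree n → ((Fin n → Bool) → Bool) → Circuit n → Set
Realises {n} T f X = SDD T X × (∀ (a : Fin n → Bool) → ⟦ X ⟧ a ≡ f a)

realises-≗ : ∀ {n T} {f h : (Fin n → Bool) → Bool} {X} → (∀ a → f a ≡ h a) →
             Realises T f X → Realises T h X
realises-≗ f≗h (sdd , sem) = sdd , λ a → trans (sem a) (f≗h a)

constant : ∀ {n k} {T : VTree n} (C : Circ n k) (b : Bool) → Growth C (Has (Realises T (λ _ → b))) 0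
constant C b = append (const b) (zero , sdd-const C b , λ a → refl)

unary : ∀ {n k} (C : Circ n k) (x : Fin n) (t f : Bool) →
        Growth C (Has (Realises (leaf x) (λ a → if a x then t else f))) 0
unary C x true  true  = append (const true)  (zero , sdd-const C true , λ a → sym (if-eta (a x)))
unary C x false false = append (const false) (zero , sdd-const C false , λ a → sym (if-eta (a x)))
unary C x true  false = append (lit x true)  (zero , sdd-lit C x true (here refl) , λ a → positive (a x))
  where positive : ∀ b → b ≡ (if b then true else false)
        positive true  = refl
        positive false = refl
unary C x false true  = append (lit x false) (zero , sdd-lit C x false (here refl) , λ a → negative (a x))
  where negative : ∀ b → not b ≡ (if b then false else true)
        negative true  = refl
        negative false = refl

primeOf subOf : ∀ {n} → Circuit n → Circuit n
primeOf (_ , C ▷ ∧g (p ∷ s ∷ [])) = sub C p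
primeOf X = X
subOf (_ , C ▷ ∧g (p ∷ s ∷ [])) = sub C s
subOf X = X

and-sem : ∀ {n} {X P S : Circuit n} → AndGate X P S → ∀ a → ⟦ X ⟧ a ≡ ⟦ P ⟧ a ∧ ⟦ S ⟧ a
and-sem (mk C p s) a rewrite eval-sub C a p | eval-sub C a s = cong (eval C a p ∧_) (∧-identityʳ _)

record Element {n} (vl vr : VTree n) (X : Circuit n) : Set where
  field
    and-gate  : AndGate X (primeOf X) (subOf X)
    prime-sdd : SDD vl (primeOf X)
    sub-sdd   : SDD vr (subOf X)
    prime-sat : ∃ λ a → ⟦ primeOf X ⟧ a ≡ true
open Element

PrimeHolds : ∀ {n} → (Fin n → Bool) → Circuit n → Set
PrimeHolds a X = ⟦ primeOf X ⟧ a ≡ true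

Disjoint : ∀ {n} → Circuit n → Circuit n → Set
Disjoint X Y = ∀ a → PrimeHolds a X → PrimeHolds a Y → ⊥

disjoint-at : ∀ {n} {A : Set} {f : A → Circuit n} (xs : List A) → AllPairs Disjoint (map f xs) →
              ∀ i j → i ≢ j → Disjoint (f (lookup xs i)) (f (lookup xs j))
disjoint-at (x ∷ xs) (d ∷ ds) zero    zero    i≢j = ⊥-elim (i≢j refl)
disjoint-at (x ∷ xs) (d ∷ ds) zero    (suc j) i≢j = all-at d j
disjoint-at (x ∷ xs) (d ∷ ds) (suc i) zero    i≢j = λ a p q → all-at d i a q p
disjoint-at (x ∷ xs) (d ∷ ds) (suc i) (suc j) i≢j = disjoint-at xs ds i j (i≢j ∘ cong suc)

decision-node : ∀ {n k} {vl vr : VTree n} (C : Circ n k) (ws : List (Fin k)) →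
                All (Element vl vr) (map (sub C) ws) → AllPairs Disjoint (map (sub C) ws) →
                (∀ a → Any (PrimeHolds a) (map (sub C) ws)) → 2 ≤ length ws →
                SDD (node vl vr) (k , C ▷ ∨g ws)
decision-node {vl = vl} {vr} C ws elems disj cover two =
  sdd-dec C ws two here P S (and-gate ∘ elem) (λ i → vl , here , prime-sdd (elem i))
          (λ i → vr , here , sub-sdd (elem i)) (prime-sat ∘ elem) exclusive (any-at ∘ cover)
  where
  elem = all-at elems
  P = λ i → primeOf (sub C (lookup ws i))
  S = λ i → subOf (sub C (lookup ws i))
  exclusive : ∀ i j → i ≢ j → ∀ a → ⟦ P i ⟧ a ≡ true → ⟦ P j ⟧ a ≡ false
  exclusive i j i≢j a p = ¬-not (λ q → disjoint-at ws disj i j i≢j a p q)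

or-sem : ∀ {n k} (C : Circ n k) (ws : List (Fin k)) a →
         ⟦ (k , C ▷ ∨g ws) ⟧ a ≡ true ⇔ Any (λ X → ⟦ X ⟧ a ≡ true) (map (sub C) ws)
or-sem C ws a = mk⇔ to from
  where
  inputs : map (eval C a) ws ≡ map (λ X → ⟦ X ⟧ a) (map (sub C) ws)
  inputs = trans (map-cong (λ i → sym (eval-sub C a i)) ws) (map-∘ ws)
  to : ⟦ (_ , C ▷ ∨g ws) ⟧ a ≡ true → Any (λ X → ⟦ X ⟧ a ≡ true) (map (sub C) ws)
  to e = Any.map (Equivalence.to T-≡)
           (any⁻ (λ X → ⟦ X ⟧ a) _ (Equivalence.from T-≡ (trans (cong BL.or (sym inputs)) e)))
  from : Any (λ X → ⟦ X ⟧ a ≡ true) (map (sub C) ws) → ⟦ (_ , C ▷ ∨g ws) ⟧ a ≡ true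
  from q = trans (cong BL.or inputs)
             (Equivalence.to T-≡ (any⁺ (λ X → ⟦ X ⟧ a) (Any.map (Equivalence.from T-≡) q)))

conjunction : ∀ {n k} {vl vr : VTree n} {f h : (Fin n → Bool) → Bool} (C : Circ n k) →
              Has (Realises vl f) C → Has (Realises vr h) C →
              Growth C (Has (λ X → AndGate X (primeOf X) (subOf X) ×
                                   Realises vl f (primeOf X) × Realises vr h (subOf X))) 2
conjunction C (p , P) (s , S) = append (∧g (p ∷ s ∷ [])) (zero , mk C p s , P , S)

-- Shannon expansion on a variable x: from SDDs for f₁ and f₀ respecting R,
-- five gates (x, ¬x, x ∧ f₁, ¬x ∧ f₀ and their ∨) with six arcs give an SDD
-- for "if x then f₁ else f₀" respecting node (leaf x) R
shannon : ∀ {n k} {R : VTree n} {f₁ f₀ : (Fin n → Bool) → Bool} (C : Circ n k) (x : Fin n) →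
          Has (Realises R f₁) C → Has (Realises R f₀) C →
          Growth C (Has (Realises (node (leaf x) R) (λ a → if a x then f₁ a else f₀ a))) 6
shannon {R = R} {f₁} {f₀} C x (s₁ , sdd₁ , sem₁) (s₀ , sdd₀ , sem₀) =
  grown (C₄ ▷ ∨g (suc zero ∷ zero ∷ []))
    (record { lift = λ i → suc (suc (suc (suc (suc i)))) ; sub-lift = λ _ → refl })
    (zero , decision-node C₄ (suc zero ∷ zero ∷ []) (positive ∷ negative ∷ [])
                          ((exclusive ∷ []) ∷ [] ∷ []) cover (s≤s (s≤s z≤n)) , sem)
    (≤-reflexive (arcs (circSize C)))
  where
  C₂ = (C ▷ lit x true) ▷ lit x false
  C₃ = C₂ ▷ ∧g (suc zero ∷ suc (suc s₁) ∷ [])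
  C₄ = C₃ ▷ ∧g (suc zero ∷ suc (suc (suc s₀)) ∷ [])
  positive : Element (leaf x) R (_ , C₃)
  positive = record { and-gate = mk C₂ (suc zero) (suc (suc s₁)) ; prime-sdd = sdd-lit C x true (here refl)
                    ; sub-sdd = sdd₁ ; prime-sat = (λ _ → true) , refl }
  negative : Element (leaf x) R (_ , C₄)
  negative = record { and-gate = mk C₃ (suc zero) (suc (suc (suc s₀)))
                    ; prime-sdd = sdd-lit (C ▷ lit x true) x false (here refl)
                    ; sub-sdd = sdd₀ ; prime-sat = (λ _ → false) , refl }
  exclusive : Disjoint (_ , C₃) (_ , C₄)
  exclusive a p q with a x
  exclusive a () q | false
  exclusive a p () | true
  cover : ∀ a → Any (PrimeHolds a) ((_ , C₃) ∷ (_ , C₄) ∷ [])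
  cover a with a x in ax
  ... | true  = here ax
  ... | false = there (here (cong not ax))
  expand : ∀ b e₁ e₀ → (b ∧ (e₁ ∧ true)) ∨ ((not b ∧ (e₀ ∧ true)) ∨ false) ≡ (if b then e₁ else e₀)
  expand true  e₁ e₀ rewrite ∧-identityʳ e₁ = ∨-identityʳ e₁
  expand false e₁ e₀ rewrite ∧-identityʳ e₀ = ∨-identityʳ e₀
  sem : ∀ a → ⟦ (_ , C₄ ▷ ∨g (suc zero ∷ zero ∷ [])) ⟧ a ≡ (if a x then f₁ a else f₀ a)
  sem a rewrite sym (eval-sub C a s₁) | sym (eval-sub C a s₀) | sem₁ a | sem₀ a = expand (a x) (f₁ a) (f₀ a)
  arcs : ∀ s → s + 0 + 0 + 2 + 2 + 2 ≡ s + 6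
  arcs = solve-∀

tabulated-snoc : ∀ {n k} {Q : ℕ → Circuit n → Set} {r} {C : Circ n k} →
                 Tabulated Q r C → Has (Q r) C → Tabulated Q (suc r) C
tabulated-snoc {r = r} tab h c c<1+r with c ≟ r
... | yes refl = h
... | no c≢r   = tab c (≤∧≢⇒< (s≤s⁻¹ c<1+r) c≢r)

tabulate-growth : ∀ {n} {E : CircPred n} {Q : ℕ → Circuit n → Set} {B δ} → Persistent E →
                  (∀ {k} (C : Circ n k) → E C → ∀ c → c < B → Growth C (Has (Q c)) δ) →
                  ∀ r → r ≤ B → ∀ {k} (C : Circ n k) → E C →
                  Growth C (λ C' → E C' × Tabulated Q r C') (r * δ)
tabulate-growth pE step zero    r≤B C e = stay (e , λ c ())
tabulate-growth {Q = Q} {δ = δ} pE step (suc r) r≤B C e =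
  weaken (≤-reflexive (+-comm (r * δ) δ))
    (tabulate-growth {Q = Q} pE step r (≤-trans (n≤1+n r) r≤B) C e >>= λ C' (e' , tab) →
     growth-map (λ {_} {C''} ((e'' , tab'') , h) → e'' , tabulated-snoc {Q = Q} {C = C''} tab'' h)
       (along (×-persistent pE (tabulated-persistent Q r)) (e' , tab) (step C' e' r r≤B)))

-- Layered automata and their SDDs over a chain vtree (their OBDDs).

-- Automaton m reads m bits; each layer maps a state and the bit read to the
-- next state, or rejects (nothing); the last state is accepted or not
data Automaton : ℕ → Set where
  accept : (ℕ → Bool) → Automaton zero
  _⇒_    : ∀ {m} → (ℕ → Bool → Maybe ℕ) → Automaton m → Automaton (suc m)

run    : ∀ {m} → Automaton m → ℕ → (Fin m → Bool) → Bool
resume : ∀ {m} → Automaton m → Maybe ℕ → (Fin m → Bool) → Bool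
run (accept F) c g = F c
run (δ ⇒ A)    c g = resume A (δ c (g zero)) (g ∘ suc)
resume A nothing  g = false
resume A (just c) g = run A c g

data Within (B : ℕ) : ∀ {m} → Automaton m → Set where
  accept : ∀ {F} → Within B (accept F)
  _⇒_    : ∀ {m δ} {A : Automaton m} → (∀ {c b c'} → c < B → δ c b ≡ just c' → c' < B) →
           Within B A → Within B (δ ⇒ A)

chain : ∀ {n m} → (Fin (suc m) → Fin n) → VTree n
chain {m = zero}  e = leaf (e zero)
chain {m = suc m} e = node (leaf (e zero)) (chain (e ∘ suc))

leaves-chain : ∀ {n m} (e : Fin (suc m) → Fin n) → leaves (chain e) ≡ tabulate e
leaves-chain {m = zero}  e = refl
leaves-chain {m = suc m} e = cong (e zero ∷_) (leaves-chain (e ∘ suc))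

StateGate : ∀ {n m} → Automaton (suc m) → (Fin (suc m) → Fin n) → ℕ → Circuit n → Set
StateGate A e c = Realises (chain e) (λ a → run A c (a ∘ e))

if-expand : ∀ {A : Set} (h : Bool → A) b → (if b then h true else h false) ≡ h b
if-expand h true  = refl
if-expand h false = refl

resume-accept : ∀ F r (g g' : Fin 0 → Bool) → resume (accept F) r g ≡ resume (accept F) r g'
resume-accept F nothing  g g' = refl
resume-accept F (just c) g g' = refl

-- an automaton of width B over m + 1 bits has SDDs over chain e for all its
-- initial states c < B, with 6 B arcs per layer (the OBDD of the automaton,
-- one Shannon node per state and layer); the last layer consists of literals
automaton-sdd : ∀ {n m B} (A : Automaton (suc m)) → Within B A → (e : Fin (suc m) → Fin n) →
                ∀ {k} (C : Circ n k) → Growth C (Tabulated (StateGate A e) B) (m * (6 * B))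
automaton-sdd {B = B} (δ ⇒ accept F) _ e C =
  weaken (≤-reflexive (*-zeroʳ B)) (growth-map proj₂
    (tabulate-growth {E = λ _ → ⊤} {Q = StateGate (δ ⇒ accept F) e} (λ _ _ → tt) last-layer B ≤-refl C tt))
  where
  last-layer : ∀ {k} (C : Circ _ k) → ⊤ → ∀ c → c < B → Growth C (Has (StateGate (δ ⇒ accept F) e c)) 0
  last-layer C _ c _ =
    growth-map (λ (i , r) → i , realises-≗ (λ a → trans (if-expand h (a (e zero)))
                                                   (resume-accept F (δ c (a (e zero))) _ _)) r)
               (unary C (e zero) (h true) (h false))
    where h = λ b → resume (accept F) (δ c b) (λ ())
automaton-sdd {m = suc m} {B} (δ ⇒ A) (δ-within ⇒ A-within) e C =
  weaken (≤-reflexive (arcs m B))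
    (automaton-sdd A A-within (e ∘ suc) C >>= λ C₁ tab →
     along (tabulated-persistent (StateGate A (e ∘ suc)) B) tab (constant C₁ false) >>= λ C₂ env →
     growth-map proj₂ (tabulate-growth {Q = StateGate (δ ⇒ A) e}
       (×-persistent (tabulated-persistent (StateGate A (e ∘ suc)) B) (has-persistent (Next (λ _ → false))))
       layer B ≤-refl C₂ env))
  where
  Next = Realises (chain (e ∘ suc))
  Env : CircPred _
  Env C = Tabulated (StateGate A (e ∘ suc)) B C × Has (Next (λ _ → false)) C
  child : ∀ {k} {C : Circ _ k} → Env C → (r : Maybe ℕ) → (∀ {c'} → r ≡ just c' → c' < B) →
          Has (Next (λ a → resume A r (a ∘ e ∘ suc))) C
  child (tab , reject) nothing   _     = reject
  child (tab , reject) (just c') bound = tab c' (bound refl)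
  layer : ∀ {k} (C : Circ _ k) → Env C → ∀ c → c < B → Growth C (Has (StateGate (δ ⇒ A) e c)) 6
  layer C env c c<B =
    growth-map (λ (i , r) → i , realises-≗ (λ a → if-expand (h a) (a (e zero))) r)
      (shannon C (e zero) (child env (δ c true) (δ-within c<B)) (child env (δ c false) (δ-within c<B)))
    where h = λ a b → resume A (δ c b) (a ∘ e ∘ suc)
  arcs : ∀ m B → m * (6 * B) + (0 + B * 6) ≡ suc m * (6 * B)
  arcs = solve-∀

satisfiable? : ∀ {m} (A : Automaton m) c → Dec (∃ λ g → run A c g ≡ true)
resumable?   : ∀ {m} (A : Automaton m) r → Dec (∃ λ g → resume A r g ≡ true)
satisfiable? (accept F) c = map′ (λ e → (λ ()) , e) proj₂ (F c Bool.≟ true)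
satisfiable? (δ ⇒ A) c = map′ extend restrict (resumable? A (δ c true) ⊎-dec resumable? A (δ c false))
  where
  extend : (∃ λ g → resume A (δ c true) g ≡ true) ⊎ (∃ λ g → resume A (δ c false) g ≡ true) →
           ∃ λ g → run (δ ⇒ A) c g ≡ true
  extend (inj₁ (g , e)) = true ◂ g , e
  extend (inj₂ (g , e)) = false ◂ g , e
  restrict : (∃ λ g → run (δ ⇒ A) c g ≡ true) →
             (∃ λ g → resume A (δ c true) g ≡ true) ⊎ (∃ λ g → resume A (δ c false) g ≡ true)
  restrict (g , e) with g zero | e
  ... | true  | e' = inj₁ (g ∘ suc , e')
  ... | false | e' = inj₂ (g ∘ suc , e')
resumable? A nothing  = no λ ()
resumable? A (just c) = satisfiable? A c

digit : Bool → ℕ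
digit b = if b then 1 else 0

weight-suc : ∀ {m} (g : Fin (suc m) → Bool) → weight g ≡ digit (g zero) + weight (g ∘ suc)
weight-suc {m} g = cong (λ xs → digit (g zero) + sum xs)
  (trans (map-tabulate suc (digit ∘ g)) (sym (map-tabulate id (digit ∘ g ∘ suc))))

weight-≤ : ∀ {m} (g : Fin m → Bool) → weight g ≤ m
weight-≤ {zero}  g = z≤n
weight-≤ {suc m} g rewrite weight-suc g with g zero
... | true  = s≤s (weight-≤ (g ∘ suc))
... | false = m≤n⇒m≤1+n (weight-≤ (g ∘ suc))

weight-constant : ∀ m b → weight {m} (λ _ → b) ≡ m * digit b
weight-constant zero    b = refl
weight-constant (suc m) b = trans (weight-suc {m} (λ _ → b)) (cong (digit b +_) (weight-constant m b))

-- bitAt g p : the bit of g at 1-based position p (false at 0 and past the end)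
bitAt : ∀ {m} → (Fin m → Bool) → ℕ → Bool
bitAt {zero}  g p             = false
bitAt {suc m} g zero          = false
bitAt {suc m} g (suc zero)    = g zero
bitAt {suc m} g (suc (suc p)) = bitAt (g ∘ suc) (suc p)

bitAt-zero : ∀ {m} (g : Fin m → Bool) → bitAt g 0 ≡ false
bitAt-zero {zero}  g = refl
bitAt-zero {suc m} g = refl

bitAt-sound : ∀ {m} (g : Fin m → Bool) p → bitAt g (suc p) ≡ true → ∃ λ i → toℕ i ≡ p × g i ≡ true
bitAt-sound {suc m} g zero    e = zero , refl , e
bitAt-sound {suc m} g (suc p) e with bitAt-sound (g ∘ suc) p e
... | i , i≡p , gi = suc i , cong suc i≡p , gi

bitAt-complete : ∀ {m} (g : Fin m → Bool) i → g i ≡ true → bitAt g (suc (toℕ i)) ≡ true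
bitAt-complete {suc m} g zero    e = e
bitAt-complete {suc m} g (suc i) e = bitAt-complete (g ∘ suc) i e

agree : Bool → Bool → Bool
agree true  u = u
agree false u = not u

agree-sound : ∀ x u → agree x u ≡ true → x ≡ u
agree-sound true  true  e = refl
agree-sound false false e = refl

agree-refl : ∀ x → agree x x ≡ true
agree-refl true  = refl
agree-refl false = refl

Probe : Set
Probe = ℕ × Bool

probed : ∀ {m} → (Fin m → Bool) → Probe → Bool
probed g (p , u) = agree (bitAt g p) u

-- reading the first bit checks a probe at position 1 and retires it (the
-- probe (0 , false) always holds); any other probe moves one position closer
check : Probe → Bool → Bool
check (suc zero , u) b = agree b u
check _              b = true

shift : Probe → Probe
shift (zero , u)        = zero , u
shift (suc zero , u)    = zero , false
shift (suc (suc p) , u) = suc p , u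

probe-step : ∀ {m} (g : Fin (suc m) → Bool) π → probed g π ≡ check π (g zero) ∧ probed (g ∘ suc) (shift π)
probe-step g (zero , u)        rewrite bitAt-zero (g ∘ suc) = refl
probe-step g (suc zero , u)    rewrite bitAt-zero (g ∘ suc) = sym (∧-identityʳ _)
probe-step g (suc (suc p) , u) = refl

count : Bool → ℕ → Maybe ℕ
count false c       = just c
count true  zero    = nothing
count true  (suc c) = just c

probeAutomaton : Probe → Probe → (m : ℕ) → Automaton m
probeAutomaton π σ zero    = accept λ c → (0 ≡ᵇ c) ∧ probed {0} (λ ()) π ∧ probed {0} (λ ()) σ
probeAutomaton π σ (suc m) = (λ c b → if check π b ∧ check σ b then count b c else nothing)
                             ⇒ probeAutomaton (shift π) (shift σ) m

resume-guard : ∀ {m} (A : Automaton m) ok r g → resume A (if ok then r else nothing) g ≡ ok ∧ resume A r g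
resume-guard A true  r g = refl
resume-guard A false r g = refl

resume-count : ∀ {m} (A : Automaton m) g w R → (∀ c → run A c g ≡ (w ≡ᵇ c) ∧ R) →
               ∀ b c → resume A (count b c) g ≡ (digit b + w ≡ᵇ c) ∧ R
resume-count A g w R spec false c       = spec c
resume-count A g w R spec true  zero    = refl
resume-count A g w R spec true  (suc c) = spec c

interleave : ∀ a b c d e → (a ∧ b) ∧ (c ∧ (d ∧ e)) ≡ c ∧ ((a ∧ d) ∧ (b ∧ e))
interleave true  true  c d e = refl
interleave true  false c d e rewrite ∧-zeroʳ d | ∧-zeroʳ c = refl
interleave false b     c d e = sym (∧-zeroʳ c)

probeAutomaton-run : ∀ π σ m (g : Fin m → Bool) c →
                     run (probeAutomaton π σ m) c g ≡ (weight g ≡ᵇ c) ∧ probed g π ∧ probed g σ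
probeAutomaton-run π σ zero    g c = refl
probeAutomaton-run π σ (suc m) g c = begin
  resume A (if ok₁ ∧ ok₂ then count b c else nothing) g'
    ≡⟨ resume-guard A (ok₁ ∧ ok₂) (count b c) g' ⟩
  (ok₁ ∧ ok₂) ∧ resume A (count b c) g'
    ≡⟨ cong ((ok₁ ∧ ok₂) ∧_) (resume-count A g' _ _ (probeAutomaton-run (shift π) (shift σ) m g') b c) ⟩
  (ok₁ ∧ ok₂) ∧ ((digit b + weight g' ≡ᵇ c) ∧ (rest₁ ∧ rest₂))
    ≡⟨ interleave ok₁ ok₂ (digit b + weight g' ≡ᵇ c) rest₁ rest₂ ⟩
  (digit b + weight g' ≡ᵇ c) ∧ (ok₁ ∧ rest₁) ∧ (ok₂ ∧ rest₂)
    ≡⟨ cong₂ (λ w x → (w ≡ᵇ c) ∧ x) (sym (weight-suc g))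
             (cong₂ _∧_ (sym (probe-step g π)) (sym (probe-step g σ))) ⟩
  (weight g ≡ᵇ c) ∧ probed g π ∧ probed g σ ∎
  where
  open ≡-Reasoning
  A  = probeAutomaton (shift π) (shift σ) m
  b  = g zero
  g' = g ∘ suc
  ok₁ = check π b
  ok₂ = check σ b
  rest₁ = probed g' (shift π)
  rest₂ = probed g' (shift σ)

-- the counter never increases, so the automaton has width B for every B
probeAutomaton-within : ∀ B π σ m → Within B (probeAutomaton π σ m)
probeAutomaton-within B π σ zero    = accept
probeAutomaton-within B π σ (suc m) =
  (λ {c} {b} c<B step → ≤-<-trans (decreasing (check π b ∧ check σ b) b c step) c<B)
  ⇒ probeAutomaton-within B (shift π) (shift σ) m
  where
  decreasing : ∀ ok b c {c'} → (if ok then count b c else nothing) ≡ just c' → c' ≤ c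
  decreasing true false c       refl = ≤-refl
  decreasing true true  (suc c) refl = n≤1+n c
  decreasing true true  zero    ()
  decreasing false b c ()

-- HWB as a decision on x₁ with primes over x₂ … xₙ.

Key : Set
Key = ℕ × Bool × Bool

keyOf : ∀ {m} → (Fin m → Bool) → Key
keyOf g = weight g , bitAt g (weight g ∸ 1) , bitAt g (weight g)

-- HWB as a function of x₁ once the key of x₂ … xₙ is known: with x₁ = 1 the
-- weight is j + 1 and the bit x_{j+1} is bit j of the rest (or x₁ itself if
-- j = 0); with x₁ = 0 the weight is j and x_j is bit j − 1 of the rest
decide : Key → Bool → Bool
decide (j , u , v) z = if z then (j ≡ᵇ 0) ∨ v else u

hwb-split : ∀ {m} (a : Fin (suc m) → Bool) → HWB (suc m) a ⇔ decide (keyOf (a ∘ suc)) (a zero) ≡ true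
hwb-split {m} a = mk⇔ (λ (i , i≡w , ai) → to (a zero) refl i (trans i≡w (weight-suc a)) ai)
                      (from (a zero) refl (weight g) refl)
  where
  g = a ∘ suc
  to : ∀ b → a zero ≡ b → ∀ i → suc (toℕ i) ≡ digit b + weight g → a i ≡ true → decide (keyOf g) b ≡ true
  to true  _  zero    eq ai rewrite sym (suc-injective eq) = refl
  to true  _  (suc i) eq ai rewrite sym (suc-injective eq) = bitAt-complete g i ai
  to false a₀ zero    eq ai = ⊥-elim (Bool.not-¬ ai a₀)
  to false _  (suc i) eq ai rewrite sym eq = bitAt-complete g i ai
  weight-a : ∀ b → a zero ≡ b → ∀ j → weight g ≡ j → weight a ≡ digit b + j
  weight-a b a₀ j w = trans (weight-suc a) (cong₂ (λ x y → digit x + y) a₀ w)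
  from : ∀ b → a zero ≡ b → ∀ j → weight g ≡ j →
         decide (j , bitAt g (j ∸ 1) , bitAt g j) b ≡ true → HWB (suc m) a
  from true a₀ zero w _ = zero , sym (weight-a true a₀ 0 w) , a₀
  from true a₀ (suc j) w bit with bitAt-sound g j bit
  ... | i , i≡j , gi = suc i , sym (trans (weight-a true a₀ (suc j) w) (cong (λ x → suc (suc x)) (sym i≡j))) , gi
  from false a₀ zero w bit = ⊥-elim (Bool.not-¬ bit (bitAt-zero g))
  from false a₀ (suc zero) w bit = ⊥-elim (Bool.not-¬ bit (bitAt-zero g))
  from false a₀ (suc (suc j)) w bit with bitAt-sound g j bit
  ... | i , i≡j , gi = suc i , sym (trans (weight-a false a₀ _ w) (cong (λ x → suc (suc x)) (sym i≡j))) , gi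

prime : Key → ∀ {m} → (Fin m → Bool) → Bool
prime (j , u , v) {m} g = run (probeAutomaton (j ∸ 1 , u) (j , v) m) j g

prime⇔key : ∀ {m} (g : Fin m → Bool) t → prime t g ≡ true ⇔ keyOf g ≡ t
prime⇔key {m} g t@(j , u , v) = mk⇔ to from
  where
  spec = probeAutomaton-run (j ∸ 1 , u) (j , v) m g j
  W = weight g ≡ᵇ j
  U = agree (bitAt g (j ∸ 1)) u
  V = agree (bitAt g j) v
  key-eq : ∀ {j' u' v'} → weight g ≡ j' → bitAt g (j' ∸ 1) ≡ u' → bitAt g j' ≡ v' → keyOf g ≡ (j' , u' , v')
  key-eq refl refl refl = refl
  to : prime t g ≡ true → keyOf g ≡ t
  to e = key-eq (≡ᵇ⇒≡ (weight g) j (Equivalence.from T-≡ (Bool.∧-conicalˡ W (U ∧ V) conj)))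
                (agree-sound _ u (Bool.∧-conicalˡ U V bits)) (agree-sound _ v (Bool.∧-conicalʳ U V bits))
    where conj = trans (sym spec) e
          bits = Bool.∧-conicalʳ W (U ∧ V) conj
  from : keyOf g ≡ t → prime t g ≡ true
  from refl rewrite spec | Equivalence.to T-≡ (≡⇒≡ᵇ (weight g) (weight g) refl)
                   | agree-refl (bitAt g (weight g ∸ 1)) | agree-refl (bitAt g (weight g)) = refl

-- the arithmetic behind the size bound: 4n keys, each costing at most 6mn + 3 arcs
cubic-bound : ∀ m n → m ≤ n → 1 ≤ n → n * 4 * (m * (6 * n) + 2) + n * 4 ≤ 36 * n ^ 3
cubic-bound m n m≤n 1≤n = begin
  n * 4 * (m * (6 * n) + 2) + n * 4  ≡⟨ regroup m n ⟩
  n * 4 * (m * (6 * n) + 3)          ≤⟨ *-monoʳ-≤ (n * 4) (+-mono-≤ (*-monoˡ-≤ (6 * n) m≤n)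
                                                                  (*-monoʳ-≤ 3 (*-mono-≤ 1≤n 1≤n))) ⟩
  n * 4 * (n * (6 * n) + 3 * (n * n)) ≡⟨ cube n ⟩
  36 * n ^ 3                         ∎
  where
  open ≤-Reasoning
  regroup : ∀ m n → n * 4 * (m * (6 * n) + 2) + n * 4 ≡ n * 4 * (m * (6 * n) + 3)
  regroup = solve-∀
  cube : ∀ n → n * 4 * (n * (6 * n) + 3 * (n * n)) ≡ 36 * (n * (n * (n * 1)))
  cube = solve-∀

module HWBSDD (m : ℕ) where

  n : ℕ
  n = suc (suc m)

  primeTree : VTree n
  primeTree = chain {m = m} suc

  record Branch (ts : List Key) (X : Circuit n) : Set where
    field
      key       : Key
      key∈      : key ∈ ts
      element   : Element primeTree (leaf zero) X
      prime-sem : ∀ a → ⟦ primeOf X ⟧ a ≡ prime key (a ∘ suc)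
      sub-sem   : ∀ a → ⟦ subOf X ⟧ a ≡ decide key (a zero)
  open Branch

  branch-key : ∀ {ts X} (b : Branch ts X) a → PrimeHolds a X → keyOf (a ∘ suc) ≡ key b
  branch-key b a p = Equivalence.to (prime⇔key (a ∘ suc) (key b)) (trans (sym (prime-sem b a)) p)

  branch-true : ∀ {ts X} (b : Branch ts X) a →
                ⟦ X ⟧ a ≡ true ⇔ (PrimeHolds a X × decide (keyOf (a ∘ suc)) (a zero) ≡ true)
  branch-true {X = X} b a = mk⇔ to from
    where
    conj = and-sem (and-gate (element b)) a
    to : ⟦ X ⟧ a ≡ true → PrimeHolds a X × decide (keyOf (a ∘ suc)) (a zero) ≡ true
    to e = p , trans (cong (λ t → decide t (a zero)) (branch-key b a p)) (trans (sym (sub-sem b a)) s)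
      where p = Bool.∧-conicalˡ _ _ (trans (sym conj) e)
            s = Bool.∧-conicalʳ _ _ (trans (sym conj) e)
    from : PrimeHolds a X × decide (keyOf (a ∘ suc)) (a zero) ≡ true → ⟦ X ⟧ a ≡ true
    from (p , d) rewrite conj | p | sub-sem b a | sym (branch-key b a p) = d

  record Branches (ts : List Key) (Xs : List (Circuit n)) : Set where
    field
      branches : All (Branch ts) Xs
      disjoint : AllPairs Disjoint Xs
      covered  : ∀ a → keyOf (a ∘ suc) ∈ ts → Any (PrimeHolds a) Xs
  open Branches

  weaken-branch : ∀ {t ts X} → Branch ts X → Branch (t ∷ ts) X
  weaken-branch b = record { key = key b ; key∈ = there (key∈ b) ; element = element b
                           ; prime-sem = prime-sem b ; sub-sem = sub-sem b }

  skip : ∀ {t ts Xs} → (∀ a → keyOf (a ∘ suc) ≢ t) → Branches ts Xs → Branches (t ∷ ts) Xs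
  skip absent bs = record
    { branches = All.map weaken-branch (branches bs) ; disjoint = disjoint bs
    ; covered  = λ { a (here k≡t) → ⊥-elim (absent a k≡t) ; a (there k∈) → covered bs a k∈ } }

  -- a new key t gets a branch, disjoint from the others since its keys are new
  insert : ∀ {t ts Xs X} → ¬ t ∈ ts → (b : Branch (t ∷ ts) X) → key b ≡ t →
           Branches ts Xs → Branches (t ∷ ts) (X ∷ Xs)
  insert {t} {ts} {X = X} t∉ts b refl bs = record
    { branches = b ∷ All.map weaken-branch (branches bs)
    ; disjoint = All.map new-disjoint (branches bs) ∷ disjoint bs
    ; covered  = λ { a (here k≡t) → here (complete a k≡t) ; a (there k∈) → there (covered bs a k∈) } }
    where
    new-disjoint : ∀ {Y} → Branch ts Y → Disjoint X Y
    new-disjoint bY a pX pY =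
      t∉ts (subst (_∈ ts) (trans (sym (branch-key bY a pY)) (branch-key b a pX)) (key∈ bY))
    complete : ∀ a → keyOf (a ∘ suc) ≡ t → PrimeHolds a X
    complete a k≡t = trans (prime-sem b a) (Equivalence.from (prime⇔key (a ∘ suc) t) k≡t)

  Built : List Key → CircPred n
  Built ts {k} C = Σ (List (Fin k)) λ ws → Branches ts (map (sub C) ws) × length ws ≤ length ts

  built-persistent : ∀ ts → Persistent (Built ts)
  built-persistent ts E (ws , bs , len) =
    map (lift E) ws ,
    subst (Branches ts) (sym (trans (sym (map-∘ ws)) (map-cong (sub-lift E) ws))) bs ,
    ≤-trans (≤-reflexive (length-map (lift E) ws)) len

  vtree : VTree n
  vtree = node primeTree (leaf zero)

  vtree-valid : IsVTree vtree
  vtree-valid rewrite leaves-chain {n} {m} suc =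
    Unique.++⁺ (Unique.tabulate⁺ Fin.suc-injective) ([] ∷ []) separate ,
    λ { zero → ∈-++⁺ʳ (tabulate suc) (here refl) ; (suc x) → ∈-++⁺ˡ (∈-tabulate⁺ {f = suc} x) }
    where
    separate : Lists.Disjoint (tabulate {n = suc m} suc) (zero ∷ [])
    separate (x∈ , here refl) with ∈-tabulate⁻ {f = suc} x∈
    ... | _ , ()

  -- each key costs the OBDD of its prime, a literal and a conjunction
  per-key : ℕ
  per-key = m * (6 * n) + 2

  add-key : ∀ {ts} t → ¬ t ∈ ts → proj₁ t < n → ∀ {k} (C : Circ n k) → Built ts C →
            Growth C (Built (t ∷ ts)) per-key
  add-key {ts} t@(j , u , v) t∉ts j<n C built@(ws , bs , len)
    with satisfiable? (probeAutomaton (j ∸ 1 , u) (j , v) (suc m)) j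
  ... | no unsat = weaken z≤n (stay (ws , skip absent bs , m≤n⇒m≤1+n len))
    where absent : ∀ a → keyOf (a ∘ suc) ≢ t
          absent a k≡t = unsat (a ∘ suc , Equivalence.from (prime⇔key (a ∘ suc) t) k≡t)
  ... | yes (g , sat) =
    along (built-persistent ts) built (automaton-sdd A (probeAutomaton-within n _ _ _) suc C)
      >>= λ C₁ (built₁ , tab) →
    along (×-persistent (built-persistent ts) (has-persistent (StateGate A suc j))) (built₁ , tab j j<n)
          (unary C₁ zero ((j ≡ᵇ 0) ∨ v) u)
      >>= λ C₂ ((built₂ , prime-gate) , sub-gate) →
    along (built-persistent ts) built₂ (conjunction C₂ prime-gate sub-gate)
      >>= λ C₃ ((ws₃ , bs₃ , len₃) , (i , and , (prime-sdd , prime-sem) , (sub-sdd , sub-sem))) →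
    stay (i ∷ ws₃ , insert t∉ts (record
      { key = t ; key∈ = here refl ; prime-sem = prime-sem ; sub-sem = sub-sem
      ; element = record { and-gate = and ; prime-sdd = prime-sdd ; sub-sdd = sub-sdd
                         ; prime-sat = false ◂ g , trans (prime-sem _) sat } }) refl bs₃ , s≤s len₃)
    where A = probeAutomaton (j ∸ 1 , u) (j , v) (suc m)

  build : ∀ ts → Unique ts → All (λ t → proj₁ t < n) ts → Growth [] (Built ts) (length ts * per-key)
  build []       _                _              =
    stay ([] , record { branches = [] ; disjoint = [] ; covered = λ a () } , z≤n)
  build (t ∷ ts) (t∉ts ∷ unique) (j<n ∷ bounds) =
    weaken (≤-reflexive (+-comm (length ts * per-key) per-key))
      (build ts unique bounds >>= add-key t (AllP.All¬⇒¬Any t∉ts) j<n)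

  bools : List Bool
  bools = false ∷ true ∷ []

  keys : List Key
  keys = cartesianProduct (upTo n) (cartesianProduct bools bools)

  keys-unique : Unique keys
  keys-unique = Unique.cartesianProduct⁺ (Unique.upTo⁺ n)
                  (Unique.cartesianProduct⁺ bools-unique bools-unique)
    where bools-unique : Unique bools
          bools-unique = ((λ ()) ∷ []) ∷ [] ∷ []

  keys-bounded : All (λ t → proj₁ t < n) keys
  keys-bounded = All.tabulate λ t∈ →
    ∈-upTo⁻ (proj₁ (∈-cartesianProduct⁻ (upTo n) (cartesianProduct bools bools) t∈))

  key∈keys : ∀ (a : Fin n → Bool) → keyOf (a ∘ suc) ∈ keys
  key∈keys a = ∈-cartesianProduct⁺ (∈-upTo⁺ (s≤s (weight-≤ (a ∘ suc))))
                                   (∈-cartesianProduct⁺ (bool∈ _) (bool∈ _))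
    where bool∈ : ∀ b → b ∈ bools
          bool∈ false = here refl
          bool∈ true  = there (here refl)

  length-keys : length keys ≡ n * 4
  length-keys = trans (length-cartesianProduct (upTo n) (cartesianProduct bools bools))
                      (cong (_* 4) (length-upTo n))

  -- the construction over all keys; it is opaque, being used only through its
  -- specification (unfolding it would make typechecking compute the circuit)
  opaque
    root : Growth [] (Built keys) (length keys * per-key)
    root = build keys keys-unique keys-bounded

  open Growth root
  ws     = proj₁ holds
  inv    = proj₁ (proj₂ holds)
  elems  = map (sub result) ws

  circuit : Circuit n
  circuit = gates , result ▷ ∨g ws

  cover : ∀ a → Any (PrimeHolds a) elems
  cover a = covered inv a (key∈keys a)

  -- the all-false and all-true assignments fall into different branches
  two-branches : 2 ≤ length ws
  two-branches = subst (2 ≤_) (length-map (sub result) ws)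
    (at-least-two (any-with (branches inv) (cover (λ _ → false)) _,_) (cover (λ _ → true)) separate)
    where
    separate : ∀ {X} → Branch keys X × PrimeHolds (λ _ → false) X → PrimeHolds (λ _ → true) X → ⊥
    separate (b , p₀) p₁ = 0≢1+n (begin
      0                                ≡⟨ sym (*-zeroʳ (suc m)) ⟩
      suc m * 0                        ≡⟨ sym (weight-constant (suc m) false) ⟩
      proj₁ (keyOf {suc m} (λ _ → false)) ≡⟨ cong proj₁ (trans (branch-key b (λ _ → false) p₀)
                                                             (sym (branch-key b (λ _ → true) p₁))) ⟩
      proj₁ (keyOf {suc m} (λ _ → true))  ≡⟨ weight-constant (suc m) true ⟩
      suc m * 1                        ≡⟨ *-identityʳ (suc m) ⟩
      suc m                            ∎)
      where open ≡-Reasoning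

  circuit-sdd : IsSDD circuit
  circuit-sdd = vtree , vtree-valid ,
    decision-node result ws (All.map element (branches inv)) (disjoint inv) cover two-branches

  circuit-computes : Computes circuit (HWB n)
  circuit-computes a = mk⇔
    (λ e → let b , x = All.lookupAny (branches inv) (Equivalence.to (or-sem result ws a) e)
           in Equivalence.from (hwb-split a) (proj₂ (Equivalence.to (branch-true b a) x)))
    (λ h → Equivalence.from (or-sem result ws a)
             (any-with (branches inv) (cover a)
                       (λ b p → Equivalence.from (branch-true b a) (p , Equivalence.to (hwb-split a) h))))

  -- the budget of the construction plus one arc per branch
  size-count : size circuit ≤ length keys * per-key + length keys
  size-count = +-mono-≤ bounded (proj₂ (proj₂ holds))

  circuit-size : size circuit ≤ 36 * n ^ 3
  circuit-size = ≤-trans size-count (≤-trans (≤-reflexive (cong (λ l → l * per-key + l) length-keys))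
                                             (cubic-bound m n (m≤n⇒m≤1+n (n≤1+n m)) (s≤s z≤n)))

theorem3 : ∃ λ (c : ℕ) → ∃ λ (N : ℕ) → ∀ (n : ℕ) → N ≤ n →
             ∃ λ (C : Circuit n) → IsSDD C × Computes C (HWB n) × size C ≤ c * n ^ 3
theorem3 = 36 , 2 , hwb-sdd
  where
  hwb-sdd : ∀ n → 2 ≤ n → ∃ λ (C : Circuit n) → IsSDD C × Computes C (HWB n) × size C ≤ 36 * n ^ 3
  hwb-sdd (suc (suc m)) _ = circuit , circuit-sdd , circuit-computes , circuit-size
    where open HWBSDD m
  hwb-sdd (suc zero) (s≤s ())
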